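{- Let $G$ be a $2$-connected graph with an odd number of vertices and at least $4$ vertices. Then $G$ has independence number at most $2$ if and only if $G$ is equimatchable and factor-critical and, for every edge $e$ of the complement $\overline{G}$ of $G$, the graph $G+e$ (obtained from $G$ by adding the edge $e$) is equimatchable.
   Context: All graphs are finite, simple and undirected. A graph is equimatchable if every maximal matching is a maximum matching. A graph is factor-critical if $G-v$ has a perfect matching for every vertex $v$. The independence number is the maximum size of an independent set of vertices. -}

module Defs where

open import Data.Nat using (ℕ; zero; suc; _≤_; _%_)
open import Data.Fin using (Fin; punchIn; _≟_)
open import Data.Bool using (Bool; true; false; _∨_; _∧_)
open import Data.Bool.Properties using (∧-comm; ∨-comm)
open import Data.Empty using (⊥; ⊥-elim)
open import Data.Unit using (⊤)
open import Data.List using (List; []; _∷_; length; concatMap)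
open import Data.List.Relation.Unary.All using (All)
open import Data.List.Relation.Unary.Unique.Propositional using (Unique)
open import Data.List.Membership.Propositional using (_∈_)
open import Data.Product using (_×_; _,_; Σ)
open import Data.Sum using (_⊎_)
open import Relation.Nullary using (¬_; yes; no)
open import Relation.Nullary.Decidable using (⌊_⌋)
open import Relation.Binary.PropositionalEquality using (_≡_; _≢_; refl)

record Graph (n : ℕ) : Set where
  field
    adj    : Fin n → Fin n → Bool
    sym    : ∀ u v → adj u v ≡ adj v u
    irrefl : ∀ v → adj v v ≡ false
open Graph public

data Walk {n : ℕ} (G : Graph n) : Fin n → Fin n → Set where
  here  : ∀ {u} → Walk G u u
  step  : ∀ {u w v} → adj G u w ≡ true → Walk G w v → Walk G u v

Edge : ∀ {n} → Graph n → Fin n → Fin n → Set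
Edge G u v = adj G u v ≡ true

deleteVertex : ∀ {m} → Graph (suc m) → Fin (suc m) → Graph m
deleteVertex G v = record
  { adj    = λ i j → adj G (punchIn v i) (punchIn v j)
  ; sym    = λ i j → sym G (punchIn v i) (punchIn v j)
  ; irrefl = λ i → irrefl G (punchIn v i) }

addEdge : ∀ {n} → Graph n → (u v : Fin n) → u ≢ v → Graph n
addEdge {n} G u v u≢v = record { adj = a ; sym = s ; irrefl = r }
  where
  new : Fin n → Fin n → Bool
  new i j = (⌊ i ≟ u ⌋ ∧ ⌊ j ≟ v ⌋) ∨ (⌊ i ≟ v ⌋ ∧ ⌊ j ≟ u ⌋)
  a : Fin n → Fin n → Bool
  a i j = adj G i j ∨ new i j
  s : ∀ i j → a i j ≡ a j i
  s i j rewrite sym G i j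
              | ∧-comm ⌊ i ≟ u ⌋ ⌊ j ≟ v ⌋
              | ∧-comm ⌊ i ≟ v ⌋ ⌊ j ≟ u ⌋
              | ∨-comm (⌊ j ≟ v ⌋ ∧ ⌊ i ≟ u ⌋) (⌊ j ≟ u ⌋ ∧ ⌊ i ≟ v ⌋) = refl
  r : ∀ i → a i i ≡ false
  r i rewrite irrefl G i with i ≟ u | i ≟ v
  ... | yes refl | yes refl = ⊥-elim (u≢v refl)
  ... | yes _ | no _ = refl
  ... | no _ | yes _ = refl
  ... | no _ | no _ = refl

Connected : ∀ {n} → Graph n → Set
Connected G = ∀ u v → Walk G u v

TwoConnected : ∀ {n} → Graph n → Set
TwoConnected {zero} G = ⊥
TwoConnected {suc m} G =
  3 ≤ suc m × Connected G × (∀ v → Connected (deleteVertex G v))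

endpoints : ∀ {n} → List (Fin n × Fin n) → List (Fin n)
endpoints = concatMap (λ { (u , v) → u ∷ v ∷ [] })

IsMatching : ∀ {n} → Graph n → List (Fin n × Fin n) → Set
IsMatching G M = All (λ { (u , v) → Edge G u v }) M × Unique (endpoints M)

IsMaximumMatching : ∀ {n} → Graph n → List (Fin n × Fin n) → Set
IsMaximumMatching G M =
  IsMatching G M × (∀ M′ → IsMatching G M′ → length M′ ≤ length M)

IsMaximalMatching : ∀ {n} → Graph n → List (Fin n × Fin n) → Set
IsMaximalMatching G M =
  IsMatching G M × (∀ u v → Edge G u v → (u ∈ endpoints M) ⊎ (v ∈ endpoints M))

Equimatchable : ∀ {n} → Graph n → Set
Equimatchable G = ∀ M → IsMaximalMatching G M → IsMaximumMatching G M

HasPerfectMatching : ∀ {n} → Graph n → Set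
HasPerfectMatching G = Σ _ λ M → IsMatching G M × (∀ v → v ∈ endpoints M)

FactorCritical : ∀ {n} → Graph n → Set
FactorCritical {zero} G = ⊤
FactorCritical {suc m} G = ∀ v → HasPerfectMatching (deleteVertex G v)

IsIndependent : ∀ {n} → Graph n → List (Fin n) → Set
IsIndependent G S = Unique S × (∀ u v → u ∈ S → v ∈ S → ¬ Edge G u v)

IndependenceNumber≤ : ∀ {n} → Graph n → ℕ → Set
IndependenceNumber≤ G k = ∀ S → IsIndependent G S → length S ≤ k

-- (⇒) The vertices left uncovered by a maximal matching are independent, so if α(G) ≤ 2 there
-- are at most two of them. By parity there is exactly one in G and in every G + e, making these
-- graphs equimatchable, and none or two in G - v. In the latter case the two uncovered vertices
-- x, y are non-adjacent, hence dominate G - v, and a walk from x to y in the connected graph G - v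
-- crosses an edge along which the matching can be rerouted to also cover x and y.
-- (⇐) Factor-criticality gives a matching of size (n - 1)/2 in G and in every G + e, so in these
-- equimatchable graphs a matching whose uncovered vertices are independent leaves at most one
-- vertex uncovered. For an independent triple a, b, c take a maximal matching N of G - {a, b, c}.
-- Extending N by ab (and by an edge from c, if c has an uncovered neighbour) in G + ab shows that
-- N leaves at most two vertices outside {a, b, c} uncovered; either N, or N plus an edge ww′ in
-- G + ww′, is then a matching whose uncovered vertices are independent but include both a and b.

module Submission where

open import Defs
open import Data.Nat using (ℕ; zero; suc; _+_; _*_; _≤_; z≤n; s≤s; _%_)
open import Data.Nat.Properties using (≤-reflexive; *-monoˡ-≤; +-cancelʳ-≤; m≤n+m; module ≤-Reasoning)
open import Data.Nat.DivMod using ([m+kn]%n≡m%n)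
open import Data.Fin using (Fin; zero; punchIn) renaming (_≟_ to _≟ᶠ_)
open import Data.Fin.Properties using (punchIn-injective; any?)
open import Data.Bool using (true)
import Data.Bool as Bool
open import Data.Bool.Properties using (∨-zeroʳ; ∨-identityʳ)
open import Data.List using (List; []; _∷_; length; _++_; map; filter; allFin; cartesianProduct)
open import Data.List.Properties using (length-++; length-map; length-tabulate)
open import Data.List.Relation.Unary.All as All using (All; []; _∷_)
open import Data.List.Relation.Unary.All.Properties using (¬Any⇒All¬)
open import Data.List.Relation.Unary.Any using (here; there)
open import Data.List.Relation.Unary.AllPairs using ([]; _∷_)
open import Data.List.Relation.Unary.Unique.Propositional using (Unique)
import Data.List.Relation.Unary.Unique.Propositional.Properties as Unique
open import Data.List.Membership.Propositional using (_∈_; _∉_)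
open import Data.List.Membership.Propositional.Properties
  using (∈-allFin; ∈-filter⁺; ∈-filter⁻; ∈-++⁺ˡ; ∈-++⁺ʳ; ∈-map⁻; ∈-cartesianProduct⁺)
open import Data.List.Membership.Propositional.Properties.WithK using (unique∧set⇒bag)
import Data.List.Membership.DecPropositional as DecMembership
open import Data.List.Relation.Binary.BagAndSetEquality using (∼bag⇒↭)
open import Data.List.Relation.Binary.Permutation.Propositional
  using (_↭_; prep; swap; ↭-refl; ↭-sym; ↭-trans; ↭⇒↭ₛ; module PermutationReasoning)
open import Data.List.Relation.Binary.Permutation.Propositional.Properties
  using (↭-length; ∈-resp-↭; shift; shifts)
import Data.List.Relation.Binary.Permutation.Setoid.Properties as PermutationSetoid
open import Data.List.Relation.Binary.Subset.Propositional using (_⊆_)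
open import Data.List.Relation.Binary.Subset.Propositional.Properties using (xs⊆xs++ys)
open import Data.Product using (_×_; _,_; proj₁; proj₂; ∃; ∃₂; uncurry)
open import Data.Sum using (_⊎_; inj₁; inj₂)
import Data.Sum as Sum
open import Data.Empty using (⊥; ⊥-elim)
open import Data.Unit using (⊤; tt)
open import Function using (_∘_; id)
open import Function.Bundles using (_⇔_; mk⇔)
open import Relation.Unary using (Decidable)
open import Relation.Nullary using (¬_; Dec; yes; no)
open import Relation.Nullary.Decidable using (_×-dec_; _⊎-dec_)
open import Relation.Binary.PropositionalEquality
  using (_≡_; _≢_; refl; trans; cong; subst) renaming (sym to ≡-sym)
import Relation.Binary.PropositionalEquality as ≡

Pairs : ℕ → Set
Pairs n = List (Fin n × Fin n)

∈-length≤1 : ∀ {A : Set} {xs : List A} {a b} → length xs ≤ 1 → a ∈ xs → b ∈ xs → a ≡ b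
∈-length≤1 {xs = _ ∷ []}    _        (here refl) (here refl) = refl
∈-length≤1 {xs = _ ∷ _ ∷ _} (s≤s ()) _           _

half-≤ : ∀ j k → j * 2 ≤ suc (k * 2) → j ≤ k
half-≤ zero    k       _              = z≤n
half-≤ (suc j) zero    (s≤s ())
half-≤ (suc j) (suc k) (s≤s (s≤s le)) = s≤s (half-≤ j k le)

odd⇒pred-even : ∀ m → suc m % 2 ≡ 1 → m % 2 ≡ 0
odd⇒pred-even 0             _   = refl
odd⇒pred-even 1             ()
odd⇒pred-even (suc (suc m)) odd = odd⇒pred-even m odd

Unique-resp-↭ : ∀ {A : Set} {xs ys : List A} → xs ↭ ys → Unique xs → Unique ys
Unique-resp-↭ {A} = PermutationSetoid.Unique-resp-↭ (≡.setoid A) ∘ ↭⇒↭ₛ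

module _ {n : ℕ} where

  open DecMembership (_≟ᶠ_ {n}) using (_∈?_; _∉?_)

  private
    variable
      G : Graph n
      M : Pairs n
      u v w x y : Fin n
      S T : List (Fin n)

  Edge-sym : ∀ G → Edge G u v → Edge G v u
  Edge-sym {u} {v} G e = trans (sym G v u) e

  Edge-irrefl : ∀ G → ¬ Edge G v v
  Edge-irrefl {v} G e with trans (≡-sym e) (irrefl G v)
  ... | ()

  Edge⇒≢ : ∀ G → Edge G u v → u ≢ v
  Edge⇒≢ G e refl = Edge-irrefl G e

  Edge? : (G : Graph n) (u v : Fin n) → Dec (Edge G u v)
  Edge? G u v = adj G u v Bool.≟ true

  walk-leaves : ∀ G {P : Fin n → Set} → Decidable P → Walk G u v → P u → ¬ P v →
    ∃₂ λ r s → P r × ¬ P s × Edge G r s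
  walk-leaves G P? here                  Pu ¬Pv = ⊥-elim (¬Pv Pu)
  walk-leaves G P? (step {w = w} e walk) Pu ¬Pv with P? w
  ... | yes Pw = walk-leaves G P? walk Pw ¬Pv
  ... | no ¬Pw = _ , w , Pu , ¬Pw , e

  -- `IsMatching` phrases edgehood by a pattern-matching lambda, which no predicate defined
  -- elsewhere is definitionally equal to; hence the conversions below.
  Edges : Graph n → Pairs n → Set
  Edges G = All (uncurry (Edge G))

  matching-edges : IsMatching G M → Edges G M
  matching-edges (es , _) = All.map (λ { {_ , _} e → e }) es

  mkMatching : Edges G M → Unique (endpoints M) → IsMatching G M
  mkMatching es u = All.map (λ { {_ , _} e → e }) es , u

  matching-∷ : Edge G u v → u ∉ endpoints M → v ∉ endpoints M → IsMatching G M → IsMatching G ((u , v) ∷ M)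
  matching-∷ {G = G} {M = M} e u∉ v∉ (es , uM) =
    e ∷ es , (Edge⇒≢ G e ∷ ¬Any⇒All¬ (endpoints M) u∉) ∷ ¬Any⇒All¬ (endpoints M) v∉ ∷ uM

  length-endpoints : (M : Pairs n) → length (endpoints M) ≡ length M * 2
  length-endpoints []      = refl
  length-endpoints (_ ∷ M) = cong (suc ∘ suc) (length-endpoints M)

  IsEnumeration : List (Fin n) → Set
  IsEnumeration L = Unique L × (∀ v → v ∈ L)

  length-enumeration : {L : List (Fin n)} → IsEnumeration L → length L ≡ n
  length-enumeration {L} (uL , all) = trans (↭-length L↭allFin) (length-tabulate id)
    where
    L↭allFin : L ↭ allFin n
    L↭allFin = ∼bag⇒↭ (unique∧set⇒bag uL (Unique.allFin⁺ n) (mk⇔ (λ _ → ∈-allFin _) (λ _ → all _)))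

  uncovered : Pairs n → List (Fin n)
  uncovered M = filter (_∉? endpoints M) (allFin n)

  ∈-uncovered⁺ : ∀ M → v ∉ endpoints M → v ∈ uncovered M
  ∈-uncovered⁺ {v = v} M = ∈-filter⁺ (_∉? endpoints M) (∈-allFin v)

  ∈-uncovered⁻ : ∀ M → v ∈ uncovered M → v ∉ endpoints M
  ∈-uncovered⁻ M = proj₂ ∘ ∈-filter⁻ (_∉? endpoints M) {xs = allFin n}

  uncovered-unique : (M : Pairs n) → Unique (uncovered M)
  uncovered-unique M = Unique.filter⁺ (_∉? endpoints M) (Unique.allFin⁺ n)

  uncovered++endpoints-enumeration : ∀ M → Unique (endpoints M) → IsEnumeration (uncovered M ++ endpoints M)
  uncovered++endpoints-enumeration M uM =
    Unique.++⁺ (uncovered-unique M) uM (λ (v∈U , v∈M) → ∈-uncovered⁻ M v∈U v∈M) , cover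
    where
    cover : ∀ v → v ∈ uncovered M ++ endpoints M
    cover v with v ∈? endpoints M
    ... | yes v∈M = ∈-++⁺ʳ (uncovered M) v∈M
    ... | no  v∉M = ∈-++⁺ˡ (∈-uncovered⁺ M v∉M)

  length-uncovered : ∀ M → Unique (endpoints M) → length (uncovered M) + length M * 2 ≡ n
  length-uncovered M uM = begin
    length (uncovered M) + length M * 2            ≡⟨ cong (length (uncovered M) +_) (≡-sym (length-endpoints M)) ⟩
    length (uncovered M) + length (endpoints M)    ≡⟨ ≡-sym (length-++ (uncovered M)) ⟩
    length (uncovered M ++ endpoints M)            ≡⟨ length-enumeration (uncovered++endpoints-enumeration M uM) ⟩
    n                                              ∎
    where open ≡.≡-Reasoning

  parity-uncovered : ∀ M → Unique (endpoints M) → n % 2 ≡ length (uncovered M) % 2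
  parity-uncovered M uM =
    trans (cong (_% 2) (≡-sym (length-uncovered M uM))) ([m+kn]%n≡m%n (length (uncovered M)) (length M) 2)

  length-matching : ∀ M → Unique (endpoints M) → length M * 2 ≤ n
  length-matching M uM = subst (length M * 2 ≤_) (length-uncovered M uM) (m≤n+m _ (length (uncovered M)))

  ∈-uncovered-∷⁺ : ∀ x y M → v ∈ uncovered M → v ≢ x → v ≢ y → v ∈ uncovered ((x , y) ∷ M)
  ∈-uncovered-∷⁺ x y M v∈ v≢x v≢y = ∈-uncovered⁺ ((x , y) ∷ M) λ
    { (here v≡x)          → v≢x v≡x
    ; (there (here v≡y))  → v≢y v≡y
    ; (there (there v∈M)) → ∈-uncovered⁻ M v∈ v∈M }

  ∈-uncovered-∷⁻ : ∀ x y M → v ∈ uncovered ((x , y) ∷ M) → v ∈ uncovered M × v ≢ x × v ≢ y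
  ∈-uncovered-∷⁻ x y M v∈ =
    ∈-uncovered⁺ M (v∉ ∘ there ∘ there) , v∉ ∘ here , v∉ ∘ there ∘ here
    where v∉ = ∈-uncovered⁻ ((x , y) ∷ M) v∈

  Independent : Graph n → List (Fin n) → Set
  Independent G S = ∀ u v → u ∈ S → v ∈ S → ¬ Edge G u v

  Independent-⊆ : S ⊆ T → Independent G T → Independent G S
  Independent-⊆ S⊆T indep u v u∈ v∈ = indep u v (S⊆T u∈) (S⊆T v∈)

  odd⇒uncovered : n % 2 ≡ 1 → IsMatching G M → ∃ (_∈ uncovered M)
  odd⇒uncovered {M = M} odd (_ , uM) with uncovered M | trans (≡-sym odd) (parity-uncovered M uM)
  ... | []    | ()
  ... | w ∷ _ | _  = w , here refl

  maximal⇒uncovered-independent : IsMaximalMatching G M → IsIndependent G (uncovered M)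
  maximal⇒uncovered-independent {M = M} (_ , saturated) = uncovered-unique M , λ u v u∈ v∈ e →
    Sum.[ ∈-uncovered⁻ M u∈ , ∈-uncovered⁻ M v∈ ] (saturated u v e)

  uncovered-independent⇒maximal : IsMatching G M → Independent G (uncovered M) → IsMaximalMatching G M
  uncovered-independent⇒maximal {G} {M} m indep = m , saturated
    where
    saturated : ∀ u v → Edge G u v → u ∈ endpoints M ⊎ v ∈ endpoints M
    saturated u v e with u ∈? endpoints M | v ∈? endpoints M
    ... | yes u∈ | _     = inj₁ u∈
    ... | no _   | yes v∈ = inj₂ v∈
    ... | no u∉  | no v∉  = ⊥-elim (indep u v (∈-uncovered⁺ M u∉) (∈-uncovered⁺ M v∉) e)

  -- Greedy maximal matchings

  record MaximalMatchingWithin (G : Graph n) (OK : Fin n → Set) (M : Pairs n) : Set where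
    field
      matching  : IsMatching G M
      inside    : ∀ {w} → w ∈ endpoints M → OK w
      saturated : ∀ u v → Edge G u v → OK u → OK v → u ∈ endpoints M ⊎ v ∈ endpoints M

  module Greedy (G : Graph n) {OK : Fin n → Set} (OK? : Decidable OK) where

    record Within (M : Pairs n) : Set where
      field
        matching : IsMatching G M
        inside   : ∀ {w} → w ∈ endpoints M → OK w

    Addable : Pairs n → Fin n × Fin n → Set
    Addable M (u , v) = Edge G u v × OK u × OK v × u ∉ endpoints M × v ∉ endpoints M

    addable? : ∀ M p → Dec (Addable M p)
    addable? M (u , v) = Edge? G u v ×-dec OK? u ×-dec OK? v ×-dec u ∉? endpoints M ×-dec v ∉? endpoints M

    Saturates : Pairs n → Pairs n → Set
    Saturates ps M = ∀ {u v} → (u , v) ∈ ps → Edge G u v → OK u → OK v → u ∈ endpoints M ⊎ v ∈ endpoints M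

    blocked⇒covered : ¬ Addable M (u , v) → Edge G u v → OK u → OK v → u ∈ endpoints M ⊎ v ∈ endpoints M
    blocked⇒covered {M} {u} {v} ¬add e ou ov with u ∈? endpoints M | v ∈? endpoints M
    ... | yes u∈ | _      = inj₁ u∈
    ... | no _   | yes v∈ = inj₂ v∈
    ... | no u∉  | no v∉  = ⊥-elim (¬add (e , ou , ov , u∉ , v∉))

    within-∷ : Within M → Addable M (u , v) → Within ((u , v) ∷ M)
    within-∷ w (e , ou , ov , u∉ , v∉) = record
      { matching = matching-∷ {G = G} e u∉ v∉ matching
      ; inside   = λ { (here refl) → ou ; (there (here refl)) → ov ; (there (there w∈)) → inside w∈ } }
      where open Within w

    greedy : ∀ ps M → Within M → ∃ λ M′ → Within M′ × endpoints M ⊆ endpoints M′ × Saturates ps M′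
    greedy []             M w = M , w , id , λ ()
    greedy ((u , v) ∷ ps) M w with addable? M (u , v)
    ... | yes add =
      let M′ , w′ , M⊆ , sat = greedy ps ((u , v) ∷ M) (within-∷ w add)
      in  M′ , w′ , M⊆ ∘ there ∘ there , λ { (here refl) _ _ _ → inj₁ (M⊆ (here refl)) ; (there p) → sat p }
    ... | no ¬add =
      let M′ , w′ , M⊆ , sat = greedy ps M w
      in  M′ , w′ , M⊆ , λ { (here refl) e ou ov → Sum.map M⊆ M⊆ (blocked⇒covered {M = M} ¬add e ou ov) ; (there p) → sat p }

  maximal-matching-within : (G : Graph n) {OK : Fin n → Set} → Decidable OK → ∃ (MaximalMatchingWithin G OK)
  maximal-matching-within G OK? =
    let M , w , _ , sat = greedy (cartesianProduct (allFin n) (allFin n)) [] (record { matching = [] , [] ; inside = λ () })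
        open Within w
    in  M , record
          { matching  = matching
          ; inside    = inside
          ; saturated = λ u v → sat (∈-cartesianProduct⁺ (∈-allFin u) (∈-allFin v)) }
    where open Greedy G OK?

  maximal-matching : (G : Graph n) → ∃ (IsMaximalMatching G)
  maximal-matching G =
    let M , max = maximal-matching-within G {OK = λ _ → ⊤} (λ _ → yes tt)
        open MaximalMatchingWithin max
    in  M , matching , λ u v e → saturated u v e tt tt

  module _ {u v : Fin n} (G : Graph n) (u≢v : u ≢ v) where

    addEdge-⊇ : Edge G x y → Edge (addEdge G u v u≢v) x y
    addEdge-⊇ e rewrite e = refl

    addEdge-new : Edge (addEdge G u v u≢v) u v
    addEdge-new with u ≟ᶠ u | v ≟ᶠ v
    ... | yes _   | yes _   = ∨-zeroʳ (adj G u v)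
    ... | no u≢u  | _       = ⊥-elim (u≢u refl)
    ... | yes _   | no v≢v  = ⊥-elim (v≢v refl)

    addEdge-edge⁻ : Edge (addEdge G u v u≢v) x y → x ≢ u → x ≢ v → Edge G x y
    addEdge-edge⁻ {x} {y} e x≢u x≢v with x ≟ᶠ u | x ≟ᶠ v
    ... | yes x≡u | _       = ⊥-elim (x≢u x≡u)
    ... | no _    | yes x≡v = ⊥-elim (x≢v x≡v)
    ... | no _    | no _    = trans (≡-sym (∨-identityʳ (adj G x y))) e

    matching-addEdge : IsMatching G M → IsMatching (addEdge G u v u≢v) M
    matching-addEdge {M} m =
      mkMatching {G = addEdge G u v u≢v} {M} (All.map (λ { {_ , _} → addEdge-⊇ }) (matching-edges {G = G} m)) (proj₂ m)

    independent-addEdge : u ∉ S → v ∉ S → Independent G S → Independent (addEdge G u v u≢v) S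
    independent-addEdge u∉ v∉ indep x y x∈ y∈ e =
      indep x y x∈ y∈ (addEdge-edge⁻ e (λ { refl → u∉ x∈ }) (λ { refl → v∉ x∈ }))

    independence-addEdge : ∀ {k} → IndependenceNumber≤ G k → IndependenceNumber≤ (addEdge G u v u≢v) k
    independence-addEdge α S (uS , indep) = α S (uS , λ a b a∈ b∈ → indep a b a∈ b∈ ∘ addEdge-⊇)

  triple-independent : ∀ {z} → x ≢ y → x ≢ z → y ≢ z →
    ¬ Edge G x y → ¬ Edge G x z → ¬ Edge G y z → IsIndependent G (x ∷ y ∷ z ∷ [])
  triple-independent {G = G} x≢y x≢z y≢z ¬xy ¬xz ¬yz = ((x≢y ∷ x≢z ∷ []) ∷ (y≢z ∷ []) ∷ [] ∷ []) , indep
    where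
    indep : Independent G _
    indep _ _ (here refl)                 (here refl)                 = Edge-irrefl G
    indep _ _ (here refl)                 (there (here refl))         = ¬xy
    indep _ _ (here refl)                 (there (there (here refl))) = ¬xz
    indep _ _ (there (here refl))         (here refl)                 = ¬xy ∘ Edge-sym G
    indep _ _ (there (here refl))         (there (here refl))         = Edge-irrefl G
    indep _ _ (there (here refl))         (there (there (here refl))) = ¬yz
    indep _ _ (there (there (here refl))) (here refl)                 = ¬xz ∘ Edge-sym G
    indep _ _ (there (there (here refl))) (there (here refl))         = ¬yz ∘ Edge-sym G
    indep _ _ (there (there (here refl))) (there (there (here refl))) = Edge-irrefl G

  nonadjacent-pair-dominates : IndependenceNumber≤ G 2 → x ≢ y → ¬ Edge G x y →
    ∀ z → z ≢ x → z ≢ y → Edge G z x ⊎ Edge G z y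
  nonadjacent-pair-dominates {G} {x} {y} α x≢y ¬xy z z≢x z≢y with Edge? G z x | Edge? G z y
  ... | yes zx | _      = inj₁ zx
  ... | no _   | yes zy = inj₂ zy
  ... | no ¬zx | no ¬zy
    with s≤s (s≤s ()) ← α _ (triple-independent {G = G} x≢y (z≢x ∘ ≡-sym) (z≢y ∘ ≡-sym) ¬xy (¬zx ∘ Edge-sym G) (¬zy ∘ Edge-sym G))

  independence≤2⇒equimatchable : n % 2 ≡ 1 → IndependenceNumber≤ G 2 → Equimatchable G
  independence≤2⇒equimatchable {G = G} odd α M max@((_ , uM) , _) = proj₁ max , λ M′ (_ , uM′) →
    half-≤ (length M′) (length M) (subst (length M′ * 2 ≤_) n≡1+2∣M∣ (length-matching M′ uM′))
    where
    one-uncovered : length (uncovered M) ≡ 1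
    one-uncovered with length (uncovered M) | α (uncovered M) (maximal⇒uncovered-independent {G = G} max)
                     | trans (≡-sym odd) (parity-uncovered M uM)
    ... | 0                 | _                | ()
    ... | 1                 | _                | _  = refl
    ... | 2                 | _                | ()
    ... | suc (suc (suc _)) | s≤s (s≤s ())     | _

    n≡1+2∣M∣ : n ≡ suc (length M * 2)
    n≡1+2∣M∣ = trans (≡-sym (length-uncovered M uM)) (cong (_+ length M * 2) one-uncovered)

  HasNearPerfectMatching : Graph n → Set
  HasNearPerfectMatching G = ∃ λ P → IsMatching G P × n ≤ suc (length P * 2)

  near-perfect-addEdge : (u≢v : u ≢ v) → HasNearPerfectMatching G → HasNearPerfectMatching (addEdge G u v u≢v)
  near-perfect-addEdge {G = G} u≢v (P , mP , n≤) = P , matching-addEdge G u≢v mP , n≤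

  at-most-one-uncovered : Equimatchable G → HasNearPerfectMatching G → IsMatching G M →
    Independent G (uncovered M) → x ∈ uncovered M → y ∈ uncovered M → x ≡ y
  at-most-one-uncovered {G} {M} equi (P , mP , n≤) m indep =
    ∈-length≤1 (+-cancelʳ-≤ (length M * 2) (length (uncovered M)) 1 bound)
    where
    P≤M : length P ≤ length M
    P≤M = proj₂ (equi M (uncovered-independent⇒maximal {G = G} m indep)) P mP
    bound : length (uncovered M) + length M * 2 ≤ 1 + length M * 2
    bound = begin
      length (uncovered M) + length M * 2  ≡⟨ length-uncovered M (proj₂ m) ⟩
      n                                    ≤⟨ n≤ ⟩
      suc (length P * 2)                   ≤⟨ s≤s (*-monoˡ-≤ 2 P≤M) ⟩
      suc (length M * 2)                   ∎
      where open ≤-Reasoning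

module _ {m : ℕ} (G : Graph (suc m)) (w : Fin (suc m)) where

  private
    lift : Fin m × Fin m → Fin (suc m) × Fin (suc m)
    lift (a , b) = punchIn w a , punchIn w b

  endpoints-lift : (M : Pairs m) → endpoints (map lift M) ≡ map (punchIn w) (endpoints M)
  endpoints-lift []            = refl
  endpoints-lift ((a , b) ∷ M) = cong (λ ps → punchIn w a ∷ punchIn w b ∷ ps) (endpoints-lift M)

  matching-deleteVertex : {M : Pairs m} → IsMatching (deleteVertex G w) M → IsMatching G (map lift M)
  matching-deleteVertex {M} (es , uM) =
    lift-edges M es , subst Unique (≡-sym (endpoints-lift M)) (Unique.map⁺ (punchIn-injective w _ _) uM)
    where
    lift-edges : ∀ M → All (λ { (a , b) → Edge (deleteVertex G w) a b }) M → All (λ { (a , b) → Edge G a b }) (map lift M)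
    lift-edges []      []       = []
    lift-edges (_ ∷ M) (e ∷ es) = e ∷ lift-edges M es

  independence-deleteVertex : ∀ {k} → IndependenceNumber≤ G k → IndependenceNumber≤ (deleteVertex G w) k
  independence-deleteVertex α S (uS , indep) =
    subst (_≤ _) (length-map (punchIn w) S)
      (α (map (punchIn w) S) (Unique.map⁺ (punchIn-injective w _ _) uS , indep′))
    where
    indep′ : Independent G (map (punchIn w) S)
    indep′ _ _ a∈ b∈ e with ∈-map⁻ (punchIn w) a∈ | ∈-map⁻ (punchIn w) b∈
    ... | a , a∈S , refl | b , b∈S , refl = indep a b a∈S b∈S e

  perfect⇒near-perfect : HasPerfectMatching (deleteVertex G w) → HasNearPerfectMatching G
  perfect⇒near-perfect (P , mP@(_ , uP) , covers) = map lift P , matching-deleteVertex mP , s≤s (≤-reflexive m≡2∣P∣)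
    where
    m≡2∣P∣ : m ≡ length (map lift P) * 2
    m≡2∣P∣ = begin
      m                         ≡⟨ ≡-sym (length-enumeration (uP , covers)) ⟩
      length (endpoints P)      ≡⟨ length-endpoints P ⟩
      length P * 2              ≡⟨ cong (_* 2) (≡-sym (length-map lift P)) ⟩
      length (map lift P) * 2   ∎
      where open ≡.≡-Reasoning

-- Rerouting a matching that misses two vertices

module _ {n : ℕ} (H : Graph n) where

  record Partner (M : Pairs n) (z : Fin n) : Set where
    field
      mate       : Fin n
      rest       : Pairs n
      edge       : Edge H z mate
      rest-edges : Edges H rest
      endpoints↭ : endpoints M ↭ z ∷ mate ∷ endpoints rest

  open Partner

  partner : ∀ {M z} → Edges H M → z ∈ endpoints M → Partner M z
  partner {(_ , v) ∷ M} (e ∷ es) (here refl) = record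
    { mate = v ; rest = M ; edge = e ; rest-edges = es ; endpoints↭ = ↭-refl }
  partner {(u , _) ∷ M} (e ∷ es) (there (here refl)) = record
    { mate = u ; rest = M ; edge = Edge-sym H e ; rest-edges = es ; endpoints↭ = swap u _ ↭-refl }
  partner {(u , v) ∷ M} {z} (e ∷ es) (there (there z∈)) = record
    { mate       = mate d
    ; rest       = (u , v) ∷ rest d
    ; edge       = edge d
    ; rest-edges = e ∷ rest-edges d
    ; endpoints↭ = ↭-trans (prep u (prep v (endpoints↭ d))) (shifts (u ∷ v ∷ []) (z ∷ mate d ∷ []))
    }
    where d = partner es z∈

  partner-in-rest : ∀ {M r s} (d : Partner M r) → Partner (rest d) s → Partner M s
  partner-in-rest {r = r} {s} d d′ = record
    { mate       = mate d′
    ; rest       = (r , mate d) ∷ rest d′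
    ; edge       = edge d′
    ; rest-edges = edge d ∷ rest-edges d′
    ; endpoints↭ = ↭-trans (endpoints↭ d) (↭-trans (prep r (prep (mate d) (endpoints↭ d′)))
                     (shifts (r ∷ mate d ∷ []) (s ∷ mate d′ ∷ [])))
    }

  mate-covered : ∀ {M z} (d : Partner M z) → mate d ∈ endpoints M
  mate-covered d = ∈-resp-↭ (↭-sym (endpoints↭ d)) (there (here refl))

  rest-covered : ∀ {M z w} (d : Partner M z) → w ∈ endpoints (rest d) → w ∈ endpoints M
  rest-covered d w∈ = ∈-resp-↭ (↭-sym (endpoints↭ d)) (there (there w∈))

  ∈-rest : ∀ {M z w} (d : Partner M z) → w ∈ endpoints M → w ≢ z → w ≢ mate d → w ∈ endpoints (rest d)
  ∈-rest d w∈ w≢z w≢z′ with ∈-resp-↭ (endpoints↭ d) w∈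
  ... | here w≡z          = ⊥-elim (w≢z w≡z)
  ... | there (here w≡z′) = ⊥-elim (w≢z′ w≡z′)
  ... | there (there w∈R) = w∈R

  module Augment {M : Pairs n} (es : Edges H M) {x y : Fin n} (enum : IsEnumeration (x ∷ y ∷ endpoints M))
                 (¬xy : ¬ Edge H x y) (dominated : ∀ z → z ≢ x → z ≢ y → Edge H z x ⊎ Edge H z y) where

    private
      x∉ : x ∉ y ∷ endpoints M
      x∉ = Unique.Unique[x∷xs]⇒x∉xs (proj₁ enum)

      y∉ : y ∉ endpoints M
      y∉ with _ ∷ unique-y∷M ← proj₁ enum = Unique.Unique[x∷xs]⇒x∉xs unique-y∷M

    covered⇒≢x : ∀ {w} → w ∈ endpoints M → w ≢ x
    covered⇒≢x w∈ refl = x∉ (there w∈)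

    covered⇒≢y : ∀ {w} → w ∈ endpoints M → w ≢ y
    covered⇒≢y w∈ refl = y∉ w∈

    covered : ∀ z → z ≢ x → z ≢ y → z ∈ endpoints M
    covered z z≢x z≢y with proj₂ enum z
    ... | here z≡x          = ⊥-elim (z≢x z≡x)
    ... | there (here z≡y)  = ⊥-elim (z≢y z≡y)
    ... | there (there z∈) = z∈

    rematch : ∀ {M′} → Edges H M′ → endpoints M′ ↭ x ∷ y ∷ endpoints M → HasPerfectMatching H
    rematch {M′} es′ p =
      M′ , mkMatching {G = H} {M′} es′ (Unique-resp-↭ (↭-sym p) (proj₁ enum)) , λ v → ∈-resp-↭ (↭-sym p) (proj₂ enum v)

    rematch-at : ∀ {z p q} (d : Partner M z) → Edge H p z → Edge H (mate d) q →
      p ∷ q ∷ endpoints M ↭ x ∷ y ∷ endpoints M → HasPerfectMatching H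
    rematch-at {z} {p} {q} d pz z′q pq↭xy = rematch (pz ∷ z′q ∷ rest-edges d) (begin
      p ∷ z ∷ mate d ∷ q ∷ endpoints (rest d)  ↭⟨ prep p (shift q (z ∷ mate d ∷ []) _) ⟩
      p ∷ q ∷ z ∷ mate d ∷ endpoints (rest d)  ↭⟨ prep p (prep q (↭-sym (endpoints↭ d))) ⟩
      p ∷ q ∷ endpoints M                       ↭⟨ pq↭xy ⟩
      x ∷ y ∷ endpoints M                       ∎)
      where open PermutationReasoning

    via-common-neighbour : ∀ {z} → Edge H z x → Edge H z y → HasPerfectMatching H
    via-common-neighbour {z} zx zy
      with d ← partner es (covered z (Edge⇒≢ H zx) (Edge⇒≢ H zy))
      with dominated (mate d) (covered⇒≢x (mate-covered d)) (covered⇒≢y (mate-covered d))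
    ... | inj₁ z′x = rematch-at d (Edge-sym H zy) z′x (swap y x ↭-refl)
    ... | inj₂ z′y = rematch-at d (Edge-sym H zx) z′y ↭-refl

    via-crossing-edge : ∀ {r s} → Edge H r x → ¬ Edge H r y → Edge H s y → ¬ Edge H s x → Edge H r s →
      HasPerfectMatching H
    via-crossing-edge {r} {s} rx ¬ry sy ¬sx rs
      with d ← partner es (covered r (Edge⇒≢ H rx) (λ { refl → ¬xy (Edge-sym H rx) }))
      with dominated (mate d) (covered⇒≢x (mate-covered d)) (covered⇒≢y (mate-covered d))
    ... | inj₂ r′y = rematch-at d (Edge-sym H rx) r′y ↭-refl
    ... | inj₁ r′x
      with d′ ← partner (rest-edges d) (∈-rest d (covered s (λ { refl → ¬xy sy }) (Edge⇒≢ H sy))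
                                          (λ { refl → Edge-irrefl H rs }) (λ { refl → ¬sx r′x }))
      with dominated (mate d′) (covered⇒≢x (rest-covered d (mate-covered d′)))
                               (covered⇒≢y (rest-covered d (mate-covered d′)))
    ... | inj₁ s′x = rematch-at (partner-in-rest d d′) (Edge-sym H sy) s′x (swap y x ↭-refl)
    ... | inj₂ s′y = rematch (Edge-sym H r′x ∷ rs ∷ s′y ∷ rest-edges d′) (begin
      x ∷ r′ ∷ r ∷ s ∷ s′ ∷ y ∷ R  ↭⟨ prep x (shift y (r′ ∷ r ∷ s ∷ s′ ∷ []) R) ⟩
      x ∷ y ∷ r′ ∷ r ∷ s ∷ s′ ∷ R  ↭⟨ prep x (prep y (swap r′ r ↭-refl)) ⟩
      x ∷ y ∷ r ∷ r′ ∷ s ∷ s′ ∷ R  ↭⟨ prep x (prep y (prep r (prep r′ (↭-sym (endpoints↭ d′))))) ⟩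
      x ∷ y ∷ r ∷ r′ ∷ endpoints (rest d)  ↭⟨ prep x (prep y (↭-sym (endpoints↭ d))) ⟩
      x ∷ y ∷ endpoints M  ∎)
      where
      open PermutationReasoning
      r′ = mate d
      s′ = mate d′
      R  = endpoints (rest d′)

    data Link : Set where
      common   : ∀ z → Edge H z x → Edge H z y → Link
      crossing : ∀ r s → Edge H r x → ¬ Edge H r y → Edge H s y → ¬ Edge H s x → Edge H r s → Link

    -- A walk from x to y must leave the closed neighbourhood of x somewhere.
    link : Connected H → Link
    link conn with walk-leaves H (λ z → z ≟ᶠ x ⊎-dec Edge? H z x) (conn x y) (inj₁ refl) ¬x-side-y
      where
      ¬x-side-y : ¬ (y ≡ x ⊎ Edge H y x)
      ¬x-side-y (inj₁ y≡x) = x∉ (here (≡-sym y≡x))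
      ¬x-side-y (inj₂ yx)   = ¬xy (Edge-sym H yx)
    ... | r , s , inj₁ refl , ¬xs , rs = ⊥-elim (¬xs (inj₂ (Edge-sym H rs)))
    ... | r , s , inj₂ rx   , ¬xs , rs with s ≟ᶠ y
    ...   | yes refl = common r rx rs
    ...   | no s≢y with dominated s (¬xs ∘ inj₁) s≢y | Edge? H r y
    ...     | inj₁ sx | _      = ⊥-elim (¬xs (inj₂ sx))
    ...     | inj₂ sy | yes ry = common r rx ry
    ...     | inj₂ sy | no ¬ry = crossing r s rx ¬ry sy (¬xs ∘ inj₂) rs

    perfect : Connected H → HasPerfectMatching H
    perfect conn with link conn
    ... | common z zx zy              = via-common-neighbour zx zy
    ... | crossing r s rx ¬ry sy ¬sx rs = via-crossing-edge rx ¬ry sy ¬sx rs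

  connected-independence≤2⇒perfect : Connected H → IndependenceNumber≤ H 2 → n % 2 ≡ 0 → HasPerfectMatching H
  connected-independence≤2⇒perfect conn α even
    with M , max@(m@(_ , uM) , _) ← maximal-matching H
    with uncovered M | uncovered++endpoints-enumeration M uM | maximal⇒uncovered-independent {G = H} max
       | trans (≡-sym even) (parity-uncovered M uM)
  ... | []                 | enum | _                        | _  = M , m , proj₂ enum
  ... | _ ∷ []             | _    | _                        | ()
  ... | x ∷ y ∷ []         | enum | ((x≢y ∷ []) ∷ _ , indep) | _  =
    Augment.perfect (matching-edges {G = H} m) enum ¬xy
      (nonadjacent-pair-dominates {G = H} α x≢y ¬xy) conn
    where
    ¬xy : ¬ Edge H x y
    ¬xy = indep x y (here refl) (there (here refl))
  ... | ys@(_ ∷ _ ∷ _ ∷ _) | _    | indep                    | _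
    with s≤s (s≤s ()) ← α ys indep

-- Independent triples

module _ {n : ℕ} {G : Graph n} (odd : n % 2 ≡ 1) (equi : Equimatchable G) (near : HasNearPerfectMatching G)
         (equi+ : ∀ u v (u≢v : u ≢ v) → ¬ Edge G u v → Equimatchable (addEdge G u v u≢v)) where

  open DecMembership (_≟ᶠ_ {n}) using (_∈?_; _∉?_)

  -- N is a maximal matching of G - {a, b, c}.
  module IndependentTriple {a b c : Fin n} (a≢b : a ≢ b) (a≢c : a ≢ c) (b≢c : b ≢ c)
                           (indep : Independent G (a ∷ b ∷ c ∷ []))
                           {N : Pairs n} (N-max : MaximalMatchingWithin G (_∉ a ∷ b ∷ c ∷ []) N) where

    abc : List (Fin n)
    abc = a ∷ b ∷ c ∷ []

    ∉abc : ∀ {v} → v ≢ a → v ≢ b → v ≢ c → v ∉ abc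
    ∉abc v≢a v≢b v≢c (here v≡a)                 = v≢a v≡a
    ∉abc v≢a v≢b v≢c (there (here v≡b))         = v≢b v≡b
    ∉abc v≢a v≢b v≢c (there (there (here v≡c))) = v≢c v≡c

    uncovered⊆abc-absurd : ∀ (H : Graph n) {M} → Equimatchable H → HasNearPerfectMatching H →
      Independent H abc → IsMatching H M → uncovered M ⊆ abc → a ∈ uncovered M → b ∈ uncovered M → ⊥
    uncovered⊆abc-absurd H equiH nearH indepH m M⊆abc a∈ b∈ =
      a≢b (at-most-one-uncovered {G = H} equiH nearH m (Independent-⊆ {G = H} M⊆abc indepH) a∈ b∈)

    open MaximalMatchingWithin N-max renaming (matching to mN)

    abc-uncovered : ∀ {v} → v ∈ abc → v ∈ uncovered N
    abc-uncovered v∈ = ∈-uncovered⁺ N λ v∈N → inside v∈N v∈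

    outside-uncovered-independent : ∀ {u v} → u ∉ abc → v ∉ abc → u ∈ uncovered N → v ∈ uncovered N → ¬ Edge G u v
    outside-uncovered-independent u∉ v∉ u∈ v∈ e =
      Sum.[ ∈-uncovered⁻ N u∈ , ∈-uncovered⁻ N v∈ ] (saturated _ _ e u∉ v∉)

    a∈N : a ∈ uncovered N
    a∈N = abc-uncovered (here refl)

    b∈N : b ∈ uncovered N
    b∈N = abc-uncovered (there (here refl))

    c∈N : c ∈ uncovered N
    c∈N = abc-uncovered (there (there (here refl)))

    G₁ : Graph n
    G₁ = addEdge G a b a≢b

    M₁ : Pairs n
    M₁ = (a , b) ∷ N

    m₁ : IsMatching G₁ M₁
    m₁ = matching-∷ {G = G₁} (addEdge-new G a≢b) (∈-uncovered⁻ N a∈N) (∈-uncovered⁻ N b∈N)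
           (matching-addEdge G a≢b mN)

    equi₁ : Equimatchable G₁
    equi₁ = equi+ a b a≢b (indep a b (here refl) (there (here refl)))

    near₁ : HasNearPerfectMatching G₁
    near₁ = near-perfect-addEdge {G = G} a≢b near

    c∈M₁ : c ∈ uncovered M₁
    c∈M₁ = ∈-uncovered-∷⁺ a b N c∈N (a≢c ∘ ≡-sym) (b≢c ∘ ≡-sym)

    neighbour-of-c-outside : ∀ {w} → Edge G c w → w ∉ abc
    neighbour-of-c-outside {w} cw = ∉abc (λ { refl → indep c w (there (there (here refl))) (here refl) cw })
                                         (λ { refl → indep c w (there (there (here refl))) (there (here refl)) cw })
                                         (λ { refl → Edge-irrefl G cw })

    -- If c has no uncovered neighbour, the vertices left uncovered by M₁ are independent in G + ab,
    -- so c is the only one; then N is a maximal matching of G leaving just a, b and c uncovered.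
    no-uncovered-neighbour-of-c : (∀ w → w ∈ uncovered N → ¬ Edge G c w) → ⊥
    no-uncovered-neighbour-of-c ¬nb =
      uncovered⊆abc-absurd G equi near indep mN uncovered⊆abc a∈N b∈N
      where
      indep₁ : Independent G₁ (uncovered M₁)
      indep₁ u v u∈ v∈ e
        with u∈N , u≢a , u≢b ← ∈-uncovered-∷⁻ a b N u∈
           | v∈N , v≢a , v≢b ← ∈-uncovered-∷⁻ a b N v∈
        with addEdge-edge⁻ G a≢b e u≢a u≢b | u ≟ᶠ c | v ≟ᶠ c
      ... | uv | yes refl | _        = ¬nb v v∈N uv
      ... | uv | no _     | yes refl = ¬nb u u∈N (Edge-sym G uv)
      ... | uv | no u≢c   | no v≢c   = outside-uncovered-independent (∉abc u≢a u≢b u≢c) (∉abc v≢a v≢b v≢c) u∈N v∈N uv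

      uncovered⊆abc : uncovered N ⊆ abc
      uncovered⊆abc {v} v∈ with v ≟ᶠ a | v ≟ᶠ b
      ... | yes v≡a | _       = here v≡a
      ... | no _    | yes v≡b = there (here v≡b)
      ... | no v≢a  | no v≢b  =
        there (there (here (at-most-one-uncovered {G = G₁} equi₁ near₁ m₁ indep₁ (∈-uncovered-∷⁺ a b N v∈ v≢a v≢b) c∈M₁)))

    -- If N leaves exactly two vertices w, w′ outside {a, b, c} uncovered, then adding ww′ to N
    -- gives a maximal matching of G + ww′ leaving a and b uncovered.
    two-outside-uncovered-absurd : ∀ {w w′} → w ∉ abc → w′ ∉ abc → w ∈ uncovered N → w′ ∈ uncovered N → w ≢ w′ →
      (∀ {v} → v ∉ abc → v ∈ uncovered N → v ≢ w → v ≡ w′) → ⊥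
    two-outside-uncovered-absurd {w} {w′} w∉abc w′∉abc w∈N w′∈N w≢w′ only-w′ =
      uncovered⊆abc-absurd G₂ (equi+ w w′ w≢w′ ¬ww′) (near-perfect-addEdge {G = G} w≢w′ near)
        (independent-addEdge G w≢w′ w∉abc w′∉abc indep) m₃ uncovered⊆abc
        (∈-uncovered-∷⁺ w w′ N a∈N (λ { refl → w∉abc (here refl) }) (λ { refl → w′∉abc (here refl) }))
        (∈-uncovered-∷⁺ w w′ N b∈N (λ { refl → w∉abc (there (here refl)) }) (λ { refl → w′∉abc (there (here refl)) }))
      where
      ¬ww′ : ¬ Edge G w w′
      ¬ww′ = outside-uncovered-independent w∉abc w′∉abc w∈N w′∈N

      G₂ : Graph n
      G₂ = addEdge G w w′ w≢w′

      m₃ : IsMatching G₂ ((w , w′) ∷ N)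
      m₃ = matching-∷ {G = G₂} (addEdge-new G w≢w′) (∈-uncovered⁻ N w∈N) (∈-uncovered⁻ N w′∈N)
             (matching-addEdge G w≢w′ mN)

      uncovered⊆abc : uncovered ((w , w′) ∷ N) ⊆ abc
      uncovered⊆abc {v} v∈ with v∈N , v≢w , v≢w′ ← ∈-uncovered-∷⁻ w w′ N v∈ | v ∈? abc
      ... | yes v∈abc = v∈abc
      ... | no  v∉abc = ⊥-elim (v≢w′ (only-w′ v∉abc v∈N v≢w))

    -- Matching c to an uncovered neighbour w in G + ab leaves a single vertex w′ uncovered.
    module UncoveredNeighbourOfC {w} (cw : Edge G c w) (w∈N : w ∈ uncovered N) where

      w∉abc : w ∉ abc
      w∉abc = neighbour-of-c-outside cw

      M₂ : Pairs n
      M₂ = (c , w) ∷ M₁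

      m₂ : IsMatching G₁ M₂
      m₂ = matching-∷ {G = G₁} (addEdge-⊇ G a≢b cw) (∈-uncovered⁻ M₁ c∈M₁)
             (∈-uncovered⁻ M₁ (∈-uncovered-∷⁺ a b N w∈N (w∉abc ∘ here) (w∉abc ∘ there ∘ here))) m₁

      uncovered₂⁺ : ∀ {v} → v ∉ abc → v ∈ uncovered N → v ≢ w → v ∈ uncovered M₂
      uncovered₂⁺ v∉abc v∈N v≢w = ∈-uncovered-∷⁺ c w M₁
        (∈-uncovered-∷⁺ a b N v∈N (v∉abc ∘ here) (v∉abc ∘ there ∘ here)) (v∉abc ∘ there ∘ there ∘ here) v≢w

      uncovered₂⁻ : ∀ {v} → v ∈ uncovered M₂ → v ∉ abc × v ∈ uncovered N × v ≢ w
      uncovered₂⁻ v∈ with v∈M₁ , v≢c , v≢w ← ∈-uncovered-∷⁻ c w M₁ v∈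
                    with v∈N , v≢a , v≢b ← ∈-uncovered-∷⁻ a b N v∈M₁
                    = ∉abc v≢a v≢b v≢c , v∈N , v≢w

      indep₂ : Independent G₁ (uncovered M₂)
      indep₂ u v u∈ v∈ e with u∉ , u∈N , _ ← uncovered₂⁻ u∈ | v∉ , v∈N , _ ← uncovered₂⁻ v∈ =
        outside-uncovered-independent u∉ v∉ u∈N v∈N (addEdge-edge⁻ G a≢b e (u∉ ∘ here) (u∉ ∘ there ∘ here))

      absurd : ⊥
      absurd with w′ , w′∈M₂ ← odd⇒uncovered {G = G₁} odd m₂
             with w′∉abc , w′∈N , w′≢w ← uncovered₂⁻ w′∈M₂ =
        two-outside-uncovered-absurd w∉abc w′∉abc w∈N w′∈N (w′≢w ∘ ≡-sym) λ v∉abc v∈N v≢w →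
          at-most-one-uncovered {G = G₁} equi₁ near₁ m₂ indep₂ (uncovered₂⁺ v∉abc v∈N v≢w) w′∈M₂

    no-independent-triple : ⊥
    no-independent-triple with any? (λ w → Edge? G c w ×-dec w ∈? uncovered N)
    ... | yes (w , cw , w∈N) = UncoveredNeighbourOfC.absurd cw w∈N
    ... | no ∄w              = no-uncovered-neighbour-of-c λ w w∈N cw → ∄w (w , cw , w∈N)

  equimatchable-extensions⇒independence≤2 : IndependenceNumber≤ G 2
  equimatchable-extensions⇒independence≤2 []           _ = z≤n
  equimatchable-extensions⇒independence≤2 (_ ∷ [])     _ = s≤s z≤n
  equimatchable-extensions⇒independence≤2 (_ ∷ _ ∷ []) _ = s≤s (s≤s z≤n)
  equimatchable-extensions⇒independence≤2 (a ∷ b ∷ c ∷ S) (((a≢b ∷ a≢c ∷ _) ∷ (b≢c ∷ _) ∷ _) , indep) =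
    ⊥-elim (IndependentTriple.no-independent-triple a≢b a≢c b≢c (Independent-⊆ {G = G} (xs⊆xs++ys (a ∷ b ∷ c ∷ []) S) indep)
              (proj₂ (maximal-matching-within G (_∉? a ∷ b ∷ c ∷ []))))

theorem19 : ∀ {n : ℕ} (G : Graph n) → TwoConnected G → n % 2 ≡ 1 → 4 ≤ n →
    (IndependenceNumber≤ G 2 ⇔
    (Equimatchable G × FactorCritical G ×
    (∀ (u v : Fin n) (u≢v : u ≢ v) → ¬ Edge G u v →
    Equimatchable (addEdge G u v u≢v))))
theorem19 {zero}  G ()
theorem19 {suc m} G (_ , _ , deletion-connected) odd _ = mk⇔
  (λ α → independence≤2⇒equimatchable {G = G} odd α
       , (λ v → connected-independence≤2⇒perfect (deleteVertex G v) (deletion-connected v)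
                  (independence-deleteVertex G v α) (odd⇒pred-even m odd))
       , λ u v u≢v _ → independence≤2⇒equimatchable {G = addEdge G u v u≢v} odd (independence-addEdge G u≢v α))
  (λ (equi , factor-critical , equi+) →
     equimatchable-extensions⇒independence≤2 {G = G} odd equi (perfect⇒near-perfect G zero (factor-critical zero)) equi+)
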